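{- Let $U:\mathcal{X}\to\mathsf{Pos}$ be a concretely order-regular category. The locally monotone functor $(-)_\ast:\mathcal{X}\to\mathsf{Rel}(\mathcal{X})^{\mathrm{co}}$ has the following properties: (1) every $f_\ast$ has a right adjoint in $\mathsf{Rel}(\mathcal{X})$; (2) $q_\ast\cdot p^\ast=g^\ast\cdot f_\ast$ for every exact square in $\mathcal{X}$ consisting of $p:W\to X_1$, $q:W\to X_2$, $f:X_1\to Z$, $g:X_2\to Z$; (3) $e_\ast\cdot e^\ast=\mathrm{Id}$ for every surjection $e$ in $\mathcal{X}$. Moreover, $(-)_\ast$ is universal with respect to these properties: for any concretely order-regular category $\mathcal{K}$, the assignment $H\mapsto H\circ(-)_\ast$ gives a bijection between locally monotone functors $H:\mathsf{Rel}(\mathcal{X})^{\mathrm{co}}\to\mathcal{K}^{\mathrm{co}}$ and locally monotone functors $F:\mathcal{X}\to\mathcal{K}^{\mathrm{co}}$ with the properties: (1') every $Ff$ has a right adjoint $(Ff)^r$ in $\mathcal{K}$; (2') $Fq\cdot(Fp)^r=(Fg)^r\cdot Ff$ for all exact squares as in (2); (3') $Fe\cdot (Fe)^r=\mathrm{Id}$ for all epis $e$.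
   Context: $\mathsf{Pos}$ is the category of posets and monotone maps; a $\mathsf{Pos}$-category is a category enriched in posets (ordered homsets, monotone composition); a locally monotone functor preserves the order on homsets; $\mathcal{C}^{\mathrm{co}}$ reverses the order of homsets. A concretely order-regular category is a locally monotone functor $U:\mathcal{C}\to\mathsf{Pos}$ such that: $U$ is order-preserving and order-reflecting on homsets; $\mathcal{C}$ has, and $U$ preserves, finite limits in the $\mathsf{Pos}$-enriched (weighted) sense (in particular comma objects); $\mathcal{C}$ has a factorisation system $(\mathcal{E},\mathcal{M})$ with $U\mathcal{E}$ = surjections and $U\mathcal{M}$ = order-embeddings, such that every (surjection, embedding)-factorisation of $Uf$ lifts uniquely to one in $\mathcal{C}$. A surjection/embedding in $\mathcal{C}$ is an arrow whose $U$-image is one. A weakening relation $R:A\looparrowright B$ of posets is a monotone map $A^{\mathrm{op}}\times B\to\mathbbm{2}$, i.e. a subset with $a'\le aRb\le b'\Rightarrow a'Rb'$; relations compose relationally ($S\cdot R$ means $R$ then $S$), identity is the order. For $f:A\to B$, $f_\ast=\{(a,b)\mid f(a)\le b\}:A\looparrowright B$ and $f^\ast=\{(b,a)\mid b\le f(a)\}:B\looparrowright A$. A $\mathcal{C}$-relation $A\looparrowright B$ is a weakening relation $UA\looparrowright UB$ whose graph (with its projections) is the $U$-image of a span in $\mathcal{C}$ (equivalently an isomorphism class of weakening-closed embedding spans). $\mathsf{Rel}(\mathcal{C})$ has the objects of $\mathcal{C}$, $\mathcal{C}$-relations as arrows, composition/identities as in posets, inclusion as order; $f_\ast$ and $f^\ast$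 are $\mathcal{C}$-relations for $f$ in $\mathcal{C}$, giving functors $(-)_\ast:\mathcal{C}\to\mathsf{Rel}(\mathcal{C})^{\mathrm{co}}$ and $(-)^\ast:\mathcal{C}^{\mathrm{op}}\to\mathsf{Rel}(\mathcal{C})$. A square $p:W\to X_1,q:W\to X_2,f:X_1\to Z,g:X_2\to Z$ in $\mathcal{C}$ is exact if $f\circ p\le g\circ q$ and for all $x\in UX_1,y\in UX_2$ with $Uf(x)\le Ug(y)$ there is $w\in UW$ with $x\le Up(w)$ and $Uq(w)\le y$. -}

module Defs where

open import Level using (Level; _⊔_; suc)
open import Data.Product using (Σ; _×_; _,_; proj₁; proj₂)
open import Relation.Binary.Bundles using (Poset)
open import Relation.Binary.PropositionalEquality using (_≡_; subst₂)

record PosCat (o h r : Level) : Set (suc (o ⊔ h ⊔ r)) where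
  infixr 9 _∘_
  infix 4 _≤_ _≈_
  field
    Obj     : Set o
    Hom     : Obj → Obj → Set h
    _≤_     : ∀ {A B} → Hom A B → Hom A B → Set r
    ≤-refl  : ∀ {A B} {f : Hom A B} → f ≤ f
    ≤-trans : ∀ {A B} {f g k : Hom A B} → f ≤ g → g ≤ k → f ≤ k
    id      : ∀ {A} → Hom A A
    _∘_     : ∀ {A B C} → Hom B C → Hom A B → Hom A C
    ∘-mono  : ∀ {A B C} {f f' : Hom A B} {g g' : Hom B C} →
              f ≤ f' → g ≤ g' → g ∘ f ≤ g' ∘ f'

  _≈_ : ∀ {A B} → Hom A B → Hom A B → Set r
  f ≈ g = f ≤ g × g ≤ f

  field
    identityˡ : ∀ {A B} {f : Hom A B} → id ∘ f ≈ f
    identityʳ : ∀ {A B} {f : Hom A B} → f ∘ id ≈ f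
    assoc     : ∀ {A B C D} {f : Hom A B} {g : Hom B C} {k : Hom C D} →
                (k ∘ g) ∘ f ≈ k ∘ (g ∘ f)

_co : ∀ {o h r} → PosCat o h r → PosCat o h r
C co = record
  { Obj = Obj ; Hom = Hom ; _≤_ = λ f g → g ≤ f
  ; ≤-refl = ≤-refl ; ≤-trans = λ p q → ≤-trans q p
  ; id = id ; _∘_ = _∘_ ; ∘-mono = ∘-mono
  ; identityˡ = proj₂ identityˡ , proj₁ identityˡ
  ; identityʳ = proj₂ identityʳ , proj₁ identityʳ
  ; assoc = proj₂ assoc , proj₁ assoc }
  where open PosCat C

record IsPosFunctor {o h r o' h' r'} (C : PosCat o h r) (D : PosCat o' h' r')
       (F₀ : PosCat.Obj C → PosCat.Obj D)
       (F₁ : ∀ {A B} → PosCat.Hom C A B → PosCat.Hom D (F₀ A) (F₀ B))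
       : Set (o ⊔ h ⊔ r ⊔ r') where
  private
    module C = PosCat C
    module D = PosCat D
  field
    F-mono : ∀ {A B} {f g : C.Hom A B} → f C.≤ g → F₁ f D.≤ F₁ g
    F-id   : ∀ {A} → F₁ (C.id {A}) D.≈ D.id
    F-comp : ∀ {A B E} (f : C.Hom A B) (g : C.Hom B E) →
             F₁ (g C.∘ f) D.≈ (F₁ g D.∘ F₁ f)

record PosFunctor {o h r o' h' r'} (C : PosCat o h r) (D : PosCat o' h' r')
       : Set (o ⊔ h ⊔ r ⊔ o' ⊔ h' ⊔ r') where
  field
    F₀    : PosCat.Obj C → PosCat.Obj D
    F₁    : ∀ {A B} → PosCat.Hom C A B → PosCat.Hom D (F₀ A) (F₀ B)
    isFun : IsPosFunctor C D F₀ F₁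

RightAdjoint : ∀ {o h r} (K : PosCat o h r) {A B : PosCat.Obj K} →
               PosCat.Hom K A B → Set (h ⊔ r)
RightAdjoint K {A} {B} f = Σ (Hom B A) λ g → (id ≤ g ∘ f) × (f ∘ g ≤ id)
  where open PosCat K

record ConcOrdReg (o h r ℓ : Level) : Set (suc (o ⊔ h ⊔ r ⊔ ℓ)) where
  field
    cat : PosCat o h r
  open PosCat cat public
  field
    U₀ : Obj → Poset ℓ ℓ ℓ

  ∣_∣ : Obj → Set ℓ
  ∣ A ∣ = Poset.Carrier (U₀ A)

  Le : ∀ A → ∣ A ∣ → ∣ A ∣ → Set ℓ
  Le A = Poset._≤_ (U₀ A)

  Eq : ∀ A → ∣ A ∣ → ∣ A ∣ → Set ℓ
  Eq A = Poset._≈_ (U₀ A)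

  field
    U₁      : ∀ {A B} → Hom A B → ∣ A ∣ → ∣ B ∣
    U₁-mono : ∀ {A B} (f : Hom A B) {x y : ∣ A ∣} → Le A x y → Le B (U₁ f x) (U₁ f y)
    U-id    : ∀ {A} (x : ∣ A ∣) → Eq A (U₁ (id {A}) x) x
    U-comp  : ∀ {A B C} (f : Hom A B) (g : Hom B C) (x : ∣ A ∣) →
              Eq C (U₁ (g ∘ f) x) (U₁ g (U₁ f x))
    U-pres  : ∀ {A B} {f g : Hom A B} → f ≤ g → ∀ x → Le B (U₁ f x) (U₁ g x)
    U-refl  : ∀ {A B} {f g : Hom A B} → (∀ x → Le B (U₁ f x) (U₁ g x)) → f ≤ g

  IsSurj : ∀ {A B} → Hom A B → Set ℓ
  IsSurj {A} {B} f = ∀ (y : ∣ B ∣) → Σ ∣ A ∣ λ x → Eq B (U₁ f x) y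

  IsEmb : ∀ {A B} → Hom A B → Set ℓ
  IsEmb {A} {B} f = ∀ (x y : ∣ A ∣) → Le B (U₁ f x) (U₁ f y) → Le A x y

  JointEmb : ∀ {W A B} → Hom W A → Hom W B → Set ℓ
  JointEmb {W} {A} {B} p q = ∀ (x y : ∣ W ∣) →
    Le A (U₁ p x) (U₁ p y) → Le B (U₁ q x) (U₁ q y) → Le W x y

  field
    -- Finite Pos-weighted limits, preserved by U: terminal object, binary
    -- products, equalisers (finite conical limits) and comma objects
    -- (which give the cotensors with 2).  Preservation = the canonical
    -- comparison into the limit in Pos is an order-isomorphism.
    -- (Uniqueness of factorisations and the 2-dimensional universal
    -- properties follow from U being order-reflecting.)
    𝟙      : Obj
    !      : ∀ A → Hom A 𝟙
    𝟙-pt   : ∣ 𝟙 ∣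
    𝟙-prop : ∀ (x y : ∣ 𝟙 ∣) → Le 𝟙 x y

    _⊗_    : Obj → Obj → Obj
    π₁     : ∀ {A B} → Hom (A ⊗ B) A
    π₂     : ∀ {A B} → Hom (A ⊗ B) B
    ⟨_,_⟩  : ∀ {V A B} → Hom V A → Hom V B → Hom V (A ⊗ B)
    π₁-β   : ∀ {V A B} {f : Hom V A} {g : Hom V B} → π₁ ∘ ⟨ f , g ⟩ ≈ f
    π₂-β   : ∀ {V A B} {f : Hom V A} {g : Hom V B} → π₂ ∘ ⟨ f , g ⟩ ≈ g
    ⊗-emb  : ∀ {A B} → JointEmb (π₁ {A} {B}) π₂
    ⊗-surj : ∀ {A B} (a : ∣ A ∣) (b : ∣ B ∣) →
             Σ ∣ A ⊗ B ∣ λ x → Eq A (U₁ π₁ x) a × Eq B (U₁ π₂ x) b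

    Eqz     : ∀ {A B} → Hom A B → Hom A B → Obj
    eqz     : ∀ {A B} {f g : Hom A B} → Hom (Eqz f g) A
    eqz-eq  : ∀ {A B} {f g : Hom A B} → f ∘ eqz {f = f} {g} ≈ g ∘ eqz
    eqz-fac : ∀ {V A B} {f g : Hom A B} (k : Hom V A) → f ∘ k ≈ g ∘ k →
              Σ (Hom V (Eqz f g)) λ u → eqz ∘ u ≈ k
    eqz-emb : ∀ {A B} {f g : Hom A B} → IsEmb (eqz {f = f} {g})
    eqz-img : ∀ {A B} {f g : Hom A B} (a : ∣ A ∣) → Eq B (U₁ f a) (U₁ g a) →
              Σ ∣ Eqz f g ∣ λ x → Eq A (U₁ eqz x) a

    Comma  : ∀ {A B C} → Hom A C → Hom B C → Obj
    cp     : ∀ {A B C} {f : Hom A C} {g : Hom B C} → Hom (Comma f g) A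
    cq     : ∀ {A B C} {f : Hom A C} {g : Hom B C} → Hom (Comma f g) B
    c-cell : ∀ {A B C} {f : Hom A C} {g : Hom B C} → f ∘ cp {f = f} {g} ≤ g ∘ cq
    c-fac  : ∀ {V A B C} {f : Hom A C} {g : Hom B C} (x : Hom V A) (y : Hom V B) →
             f ∘ x ≤ g ∘ y →
             Σ (Hom V (Comma f g)) λ u → (cp ∘ u ≈ x) × (cq ∘ u ≈ y)
    c-emb  : ∀ {A B C} {f : Hom A C} {g : Hom B C} → JointEmb (cp {f = f} {g}) cq
    c-img  : ∀ {A B C} {f : Hom A C} {g : Hom B C} (a : ∣ A ∣) (b : ∣ B ∣) →
             Le C (U₁ f a) (U₁ g b) →
             Σ ∣ Comma f g ∣ λ w → Eq A (U₁ cp w) a × Eq B (U₁ cq w) b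

    -- factorisation system (E , M) with E = surjections, M = embeddings:
    -- every arrow factors (this is the lift of the (surj,emb)-factorisation
    -- of its U-image), and E is orthogonal to M (uniqueness of the lift).
    fact : ∀ {A B} (f : Hom A B) →
           Σ Obj λ I → Σ (Hom A I) λ e → Σ (Hom I B) λ m →
             IsSurj e × IsEmb m × (m ∘ e ≈ f)
    diag : ∀ {A B C D} (e : Hom A B) (m : Hom C D) (u : Hom A C) (v : Hom B D) →
           IsSurj e → IsEmb m → m ∘ u ≈ v ∘ e →
           Σ (Hom B C) λ d → (d ∘ e ≈ u) × (m ∘ d ≈ v)

module RelDefs {o h r ℓ} (X : ConcOrdReg o h r ℓ) where
  open ConcOrdReg X

  record WRel (A B : Obj) : Set (suc ℓ) where
    field
      rel    : ∣ A ∣ → ∣ B ∣ → Set ℓ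
      weaken : ∀ {a a' b b'} → Le A a' a → rel a b → Le B b b' → rel a' b'
  open WRel public

  -- a weakening relation is a C-relation if its graph, with the two
  -- projections, is (up to iso) the U-image of a span in C
  IsCRel : ∀ {A B} → WRel A B → Set (o ⊔ h ⊔ ℓ)
  IsCRel {A} {B} R =
    Σ Obj λ W → Σ (Hom W A) λ p → Σ (Hom W B) λ q →
      (∀ a b → (rel R a b → Σ ∣ W ∣ λ w → Eq A (U₁ p w) a × Eq B (U₁ q w) b)
             × ((Σ ∣ W ∣ λ w → Eq A (U₁ p w) a × Eq B (U₁ q w) b) → rel R a b))
      × JointEmb p q

  record RelArr (A B : Obj) : Set (suc ℓ ⊔ o ⊔ h) where
    field
      wrel : WRel A B
      crel : IsCRel wrel
  open RelArr public

  infix 4 _⊆_ _≐_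
  _⊆_ : ∀ {A B} → WRel A B → WRel A B → Set ℓ
  R ⊆ S = ∀ a b → rel R a b → rel S a b

  _≐_ : ∀ {A B} → WRel A B → WRel A B → Set ℓ
  R ≐ S = (R ⊆ S) × (S ⊆ R)

  IdR : ∀ A → WRel A A
  IdR A = record
    { rel = Le A
    ; weaken = λ p q s → Poset.trans (U₀ A) p (Poset.trans (U₀ A) q s) }

  infixr 9 _·_
  _·_ : ∀ {A B C} → WRel B C → WRel A B → WRel A C
  _·_ {A} {B} {C} S R = record
    { rel = λ a c → Σ ∣ B ∣ λ b → rel R a b × rel S b c
    ; weaken = λ { p (b , x , y) s →
        b , weaken R p x (Poset.refl (U₀ B)) , weaken S (Poset.refl (U₀ B)) y s } }

  _₊ : ∀ {A B} → Hom A B → WRel A B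
  _₊ {A} {B} f = record
    { rel = λ a b → Le B (U₁ f a) b
    ; weaken = λ p q s → Poset.trans (U₀ B) (U₁-mono f p) (Poset.trans (U₀ B) q s) }

  _⁺ : ∀ {A B} → Hom A B → WRel B A
  _⁺ {A} {B} f = record
    { rel = λ b a → Le B b (U₁ f a)
    ; weaken = λ p q s → Poset.trans (U₀ B) p (Poset.trans (U₀ B) q (U₁-mono f s)) }

  ₊-crel : ∀ {A B} (f : Hom A B) → IsCRel (f ₊)
  ₊-crel {A} {B} f =
      Comma f (id {B}) , cp , cq
    , (λ a b → (λ le → c-img a b (PB.trans le (PB.reflexive (PB.Eq.sym (U-id b)))))
             , λ { (w , e₁ , e₂) →
                 PB.trans (U₁-mono f (PA.reflexive (PA.Eq.sym e₁)))
                 (PB.trans (PB.reflexive (PB.Eq.sym (U-comp cp f w)))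
                 (PB.trans (U-pres c-cell w)
                 (PB.trans (PB.reflexive (U-comp cq id w))
                 (PB.trans (PB.reflexive (U-id (U₁ cq w)))
                           (PB.reflexive e₂))))) })
    , c-emb
    where
      module PA = Poset (U₀ A)
      module PB = Poset (U₀ B)

  _₊R : ∀ {A B} → Hom A B → RelArr A B
  f ₊R = record { wrel = f ₊ ; crel = ₊-crel f }

  HasRightAdjointRel : ∀ {A B} → WRel A B → Set (suc ℓ ⊔ o ⊔ h)
  HasRightAdjointRel {A} {B} R =
    Σ (RelArr B A) λ S → (IdR A ⊆ wrel S · R) × (R · wrel S ⊆ IdR B)

  Exact : ∀ {W X₁ X₂ Z} → Hom W X₁ → Hom W X₂ → Hom X₁ Z → Hom X₂ Z → Set (r ⊔ ℓ)
  Exact {W} {X₁} {X₂} {Z} p q f g =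
    (f ∘ p ≤ g ∘ q) ×
    (∀ (x : ∣ X₁ ∣) (y : ∣ X₂ ∣) → Le Z (U₁ f x) (U₁ g y) →
       Σ ∣ W ∣ λ w → Le X₁ x (U₁ p w) × Le X₂ (U₁ q w) y)

module Universal {o h r ℓ o' h' r'} (X : ConcOrdReg o h r ℓ) (K : PosCat o' h' r') where
  open ConcOrdReg X
  open RelDefs X
  module K = PosCat K

  Props : (F₀ : Obj → K.Obj) (F₁ : ∀ {A B} → Hom A B → K.Hom (F₀ A) (F₀ B)) →
          Set (o ⊔ h ⊔ r ⊔ ℓ ⊔ h' ⊔ r')
  Props F₀ F₁ =
    Σ (∀ {A B} (f : Hom A B) → RightAdjoint K (F₁ f)) λ radj →
      (∀ {W X₁ X₂ Z} (p : Hom W X₁) (q : Hom W X₂) (f : Hom X₁ Z) (g : Hom X₂ Z) →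
         Exact p q f g → (F₁ q K.∘ proj₁ (radj p)) K.≈ (proj₁ (radj g) K.∘ F₁ f))
    × (∀ {A B} (e : Hom A B) → IsSurj e → (F₁ e K.∘ proj₁ (radj e)) K.≈ K.id)

  -- locally monotone functors H : Rel(X)^co → K^co (equivalently Rel(X) → K).
  -- The hom-sets of Rel(X) are the C-relations; composition and identities
  -- are relational composition and the order.
  record RelFunctor : Set (suc ℓ ⊔ o ⊔ h ⊔ o' ⊔ h' ⊔ r') where
    field
      H₀     : Obj → K.Obj
      H₁     : ∀ {A B} → RelArr A B → K.Hom (H₀ A) (H₀ B)
      H-mono : ∀ {A B} {R S : RelArr A B} → wrel R ⊆ wrel S → H₁ R K.≤ H₁ S
      H-id   : ∀ {A} (c : IsCRel (IdR A)) →
               H₁ (record { wrel = IdR A ; crel = c }) K.≈ K.id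
      H-comp : ∀ {A B C} (R : RelArr A B) (S : RelArr B C) (c : IsCRel (wrel S · wrel R)) →
               H₁ (record { wrel = wrel S · wrel R ; crel = c }) K.≈ (H₁ S K.∘ H₁ R)
  open RelFunctor public

  H∘₊₁ : (H : RelFunctor) → ∀ {A B} → Hom A B → K.Hom (H₀ H A) (H₀ H B)
  H∘₊₁ H f = H₁ H (f ₊R)

  FunEq : (F₀ G₀ : Obj → K.Obj)
          (F₁ : ∀ {A B} → Hom A B → K.Hom (F₀ A) (F₀ B))
          (G₁ : ∀ {A B} → Hom A B → K.Hom (G₀ A) (G₀ B)) → Set (o ⊔ h ⊔ o' ⊔ r')
  FunEq F₀ G₀ F₁ G₁ =
    Σ (∀ A → F₀ A ≡ G₀ A) λ e →
      ∀ {A B} (f : Hom A B) → subst₂ K.Hom (e A) (e B) (F₁ f) K.≈ G₁ f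

  RelFunEq : RelFunctor → RelFunctor → Set (suc ℓ ⊔ o ⊔ h ⊔ o' ⊔ r')
  RelFunEq H H' =
    Σ (∀ A → H₀ H A ≡ H₀ H' A) λ e →
      ∀ {A B} (R : RelArr A B) → subst₂ K.Hom (e A) (e B) (H₁ H R) K.≈ H₁ H' R

  UniversalProperty : Set (suc ℓ ⊔ o ⊔ h ⊔ r ⊔ o' ⊔ h' ⊔ r')
  UniversalProperty =
      (∀ (H : RelFunctor) →
         IsPosFunctor cat (K co) (H₀ H) (H∘₊₁ H) × Props (H₀ H) (H∘₊₁ H))
    × (∀ (H H' : RelFunctor) →
         FunEq (H₀ H) (H₀ H') (H∘₊₁ H) (H∘₊₁ H') → RelFunEq H H')
    × (∀ (F : PosFunctor cat (K co)) → Props (PosFunctor.F₀ F) (PosFunctor.F₁ F) →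
         Σ RelFunctor λ H →
           FunEq (H₀ H) (PosFunctor.F₀ F) (H∘₊₁ H) (PosFunctor.F₁ F))

module StarProps {o h r ℓ} (X : ConcOrdReg o h r ℓ) where
  open ConcOrdReg X
  open RelDefs X

  Functorial : Set (o ⊔ h ⊔ r ⊔ ℓ)
  Functorial =
      (∀ {A B C} (f : Hom A B) (g : Hom B C) → (g ∘ f) ₊ ≐ g ₊ · f ₊)
    × (∀ {A} → (id {A}) ₊ ≐ IdR A)
    × (∀ {A B} {f g : Hom A B} → f ≤ g → g ₊ ⊆ f ₊)

  Properties : Set (suc ℓ ⊔ o ⊔ h ⊔ r)
  Properties =
      Functorial
    × (∀ {A B} (f : Hom A B) → HasRightAdjointRel (f ₊))
    × (∀ {W X₁ X₂ Z} (p : Hom W X₁) (q : Hom W X₂) (f : Hom X₁ Z) (g : Hom X₂ Z) →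
         Exact p q f g → q ₊ · p ⁺ ≐ g ⁺ · f ₊)
    × (∀ {A B} (e : Hom A B) → IsSurj e → e ₊ · e ⁺ ≐ IdR B)

-- Every C-relation R is tabulated by a jointly embedding span (p , q), and then R = q_* · p^*.
-- Hence a functor H on Rel(X) is determined by H ∘ (-)_*, since H p^* must be the right adjoint
-- of H p_*.  Conversely F extends to R ↦ F q ∘ (F p)ʳ.  A span lying in R maps into the
-- tabulation by a span morphism u, and surjectively if it also covers R; the counit
-- F u ∘ (F u)ʳ ≤ id then gives monotonicity, and (3') makes the extension independent of the
-- tabulation.  The composite S · R is covered by the comma span of the two tabulations, whose
-- square is exact, so (2') gives functoriality.

module Submission where

open import Level using (_⊔_)
open import Data.Product using (Σ; _×_; _,_; proj₁; proj₂)
open import Relation.Binary.Bundles using (Poset)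
open import Relation.Binary.PropositionalEquality using (_≡_; refl; subst₂)
import Relation.Binary.Reasoning.PartialOrder as PartialOrderReasoning

open import Defs

module PosCatProperties {o h r} (C : PosCat o h r) where
  open PosCat C

  ≈-refl : ∀ {A B} {f : Hom A B} → f ≈ f
  ≈-refl = ≤-refl , ≤-refl

  ≈-sym : ∀ {A B} {f g : Hom A B} → f ≈ g → g ≈ f
  ≈-sym (f≤g , g≤f) = g≤f , f≤g

  ≈-trans : ∀ {A B} {f g k : Hom A B} → f ≈ g → g ≈ k → f ≈ k
  ≈-trans (f≤g , g≤f) (g≤k , k≤g) = ≤-trans f≤g g≤k , ≤-trans k≤g g≤f

  homPoset : Obj → Obj → Poset h r r
  homPoset A B = record
    { Carrier        = Hom A B
    ; _≈_            = _≈_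
    ; _≤_            = _≤_
    ; isPartialOrder = record
      { isPreorder = record
        { isEquivalence = record { refl = ≈-refl ; sym = ≈-sym ; trans = ≈-trans }
        ; reflexive     = proj₁
        ; trans         = ≤-trans
        }
      ; antisym = _,_
      }
    }

  module HomReasoning {A B : Obj} = PartialOrderReasoning (homPoset A B)

  ∘-resp-≈ : ∀ {A B C} {f f' : Hom A B} {g g' : Hom B C} → f ≈ f' → g ≈ g' → g ∘ f ≈ g' ∘ f'
  ∘-resp-≈ (f≤f' , f'≤f) (g≤g' , g'≤g) = ∘-mono f≤f' g≤g' , ∘-mono f'≤f g'≤g

  infix 4 _⊣_
  _⊣_ : ∀ {A B} → Hom A B → Hom B A → Set r
  f ⊣ g = (id ≤ g ∘ f) × (f ∘ g ≤ id)

  ⊣-rightAdjoint-≤ : ∀ {A B} {f : Hom A B} {g g' : Hom B A} → f ⊣ g → f ⊣ g' → g ≤ g'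
  ⊣-rightAdjoint-≤ {f = f} {g} {g'} (_ , counit) (unit' , _) = begin
    g              ≈⟨ identityˡ ⟨
    id ∘ g         ≤⟨ ∘-mono ≤-refl unit' ⟩
    (g' ∘ f) ∘ g   ≈⟨ assoc ⟩
    g' ∘ (f ∘ g)   ≤⟨ ∘-mono counit ≤-refl ⟩
    g' ∘ id        ≈⟨ identityʳ ⟩
    g'             ∎
    where open HomReasoning

  ⊣-rightAdjoint-unique : ∀ {A B} {f : Hom A B} {g g' : Hom B A} → f ⊣ g → f ⊣ g' → g ≈ g'
  ⊣-rightAdjoint-unique f⊣g f⊣g' = ⊣-rightAdjoint-≤ f⊣g f⊣g' , ⊣-rightAdjoint-≤ f⊣g' f⊣g

  ⊣-respˡ-≈ : ∀ {A B} {f f' : Hom A B} {g : Hom B A} → f ≈ f' → f ⊣ g → f' ⊣ g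
  ⊣-respˡ-≈ (f≤f' , f'≤f) (unit , counit) =
    ≤-trans unit (∘-mono f≤f' ≤-refl) , ≤-trans (∘-mono ≤-refl f'≤f) counit

  ⊣-id : ∀ {A} → id {A} ⊣ id
  ⊣-id = proj₂ identityˡ , proj₁ identityˡ

  ⊣-∘ : ∀ {A B C} {f : Hom A B} {g : Hom B A} {f' : Hom B C} {g' : Hom C B} →
        f ⊣ g → f' ⊣ g' → f' ∘ f ⊣ g ∘ g'
  ⊣-∘ {f = f} {g} {f'} {g'} (unit , counit) (unit' , counit') =
      (begin
        id                   ≤⟨ unit ⟩
        g ∘ f                ≈⟨ ∘-resp-≈ identityˡ ≈-refl ⟨
        g ∘ (id ∘ f)         ≤⟨ ∘-mono (∘-mono ≤-refl unit') ≤-refl ⟩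
        g ∘ ((g' ∘ f') ∘ f)  ≈⟨ ∘-resp-≈ assoc ≈-refl ⟩
        g ∘ (g' ∘ (f' ∘ f))  ≈⟨ assoc ⟨
        (g ∘ g') ∘ (f' ∘ f)  ∎)
    , (begin
        (f' ∘ f) ∘ (g ∘ g')  ≈⟨ assoc ⟩
        f' ∘ (f ∘ (g ∘ g'))  ≈⟨ ∘-resp-≈ assoc ≈-refl ⟨
        f' ∘ ((f ∘ g) ∘ g')  ≤⟨ ∘-mono (∘-mono ≤-refl counit) ≤-refl ⟩
        f' ∘ (id ∘ g')       ≈⟨ ∘-resp-≈ identityˡ ≈-refl ⟩
        f' ∘ g'              ≤⟨ counit' ⟩
        id                   ∎)
    where open HomReasoning

  subst₂-∘ : ∀ {A A' B B' C C'} (eA : A ≡ A') (eB : B ≡ B') (eC : C ≡ C') (f : Hom A B) (g : Hom B C) →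
             subst₂ Hom eA eC (g ∘ f) ≈ subst₂ Hom eB eC g ∘ subst₂ Hom eA eB f
  subst₂-∘ refl refl refl f g = ≈-refl

  subst₂-resp-≈ : ∀ {A A' B B'} (eA : A ≡ A') (eB : B ≡ B') {f g : Hom A B} → f ≈ g →
                  subst₂ Hom eA eB f ≈ subst₂ Hom eA eB g
  subst₂-resp-≈ refl refl f≈g = f≈g

  subst₂-⊣ : ∀ {A A' B B'} (eA : A ≡ A') (eB : B ≡ B') {f : Hom A B} {g : Hom B A} → f ⊣ g →
             subst₂ Hom eA eB f ⊣ subst₂ Hom eB eA g
  subst₂-⊣ refl refl f⊣g = f⊣g

module Concrete {o h r ℓ} (X : ConcOrdReg o h r ℓ) where
  open ConcOrdReg X
  open RelDefs X
  open PosCatProperties cat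

  module Pt (A : Obj) = Poset (U₀ A)
  module PtReasoning (A : Obj) = PartialOrderReasoning (U₀ A)

  U-resp-≈ : ∀ {A B} {f g : Hom A B} → f ≈ g → ∀ x → Eq B (U₁ f x) (U₁ g x)
  U-resp-≈ {B = B} (f≤g , g≤f) x = Pt.antisym B (U-pres f≤g x) (U-pres g≤f x)

  U₁-cong : ∀ {A B} (f : Hom A B) {x y : ∣ A ∣} → Eq A x y → Eq B (U₁ f x) (U₁ f y)
  U₁-cong {A} {B} f x≈y =
    Pt.antisym B (U₁-mono f (Pt.reflexive A x≈y)) (U₁-mono f (Pt.reflexive A (Pt.Eq.sym A x≈y)))

  U-square-≤ : ∀ {A B B' C} {f : Hom A B} {g : Hom B C} {f' : Hom A B'} {g' : Hom B' C} →
               g ∘ f ≤ g' ∘ f' → ∀ x → Le C (U₁ g (U₁ f x)) (U₁ g' (U₁ f' x))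
  U-square-≤ {C = C} {f} {g} {f'} {g'} sq x = begin
    U₁ g (U₁ f x)    ≈⟨ U-comp f g x ⟨
    U₁ (g ∘ f) x     ≤⟨ U-pres sq x ⟩
    U₁ (g' ∘ f') x   ≈⟨ U-comp f' g' x ⟩
    U₁ g' (U₁ f' x)  ∎
    where open PtReasoning C

  U-square : ∀ {A B B' C} {f : Hom A B} {g : Hom B C} {f' : Hom A B'} {g' : Hom B' C} →
             g ∘ f ≈ g' ∘ f' → ∀ x → Eq C (U₁ g (U₁ f x)) (U₁ g' (U₁ f' x))
  U-square {C = C} (lhs≤rhs , rhs≤lhs) x = Pt.antisym C (U-square-≤ lhs≤rhs x) (U-square-≤ rhs≤lhs x)

  U-triangle : ∀ {A B C} {f : Hom A B} {g : Hom B C} {k : Hom A C} →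
               g ∘ f ≈ k → ∀ x → Eq C (U₁ g (U₁ f x)) (U₁ k x)
  U-triangle {C = C} {f} {g} g∘f≈k x = Pt.Eq.trans C (Pt.Eq.sym C (U-comp f g x)) (U-resp-≈ g∘f≈k x)

  U-π₁-⟨,⟩ : ∀ {V A B} {f : Hom V A} {g : Hom V B} x → Eq A (U₁ π₁ (U₁ ⟨ f , g ⟩ x)) (U₁ f x)
  U-π₁-⟨,⟩ = U-triangle π₁-β

  U-π₂-⟨,⟩ : ∀ {V A B} {f : Hom V A} {g : Hom V B} x → Eq B (U₁ π₂ (U₁ ⟨ f , g ⟩ x)) (U₁ g x)
  U-π₂-⟨,⟩ = U-triangle π₂-β

  jointEmb-≈ : ∀ {W A B} {p : Hom W A} {q : Hom W B} → JointEmb p q → ∀ {x y} →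
               Eq A (U₁ p x) (U₁ p y) → Eq B (U₁ q x) (U₁ q y) → Eq W x y
  jointEmb-≈ {W} {A} {B} je {x} {y} px≈py qx≈qy = Pt.antisym W
    (je x y (Pt.reflexive A px≈py) (Pt.reflexive B qx≈qy))
    (je y x (Pt.reflexive A (Pt.Eq.sym A px≈py)) (Pt.reflexive B (Pt.Eq.sym B qx≈qy)))

  U-comp-≤ : ∀ {A B C} (f : Hom A B) (g : Hom B C) {x y} →
             Le C (U₁ (g ∘ f) x) (U₁ (g ∘ f) y) → Le C (U₁ g (U₁ f x)) (U₁ g (U₁ f y))
  U-comp-≤ {C = C} f g {x} {y} le =
    Pt.trans C (Pt.reflexive C (Pt.Eq.sym C (U-comp f g x))) (Pt.trans C le (Pt.reflexive C (U-comp f g y)))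

  jointEmb-∘ : ∀ {W V A B} {ι : Hom W V} {g₁ : Hom V A} {g₂ : Hom V B} →
               JointEmb g₁ g₂ → IsEmb ι → JointEmb (g₁ ∘ ι) (g₂ ∘ ι)
  jointEmb-∘ {ι = ι} {g₁} {g₂} je ι-emb x y ≤₁ ≤₂ =
    ι-emb x y (je (U₁ ι x) (U₁ ι y) (U-comp-≤ ι g₁ ≤₁) (U-comp-≤ ι g₂ ≤₂))

  ⟨,⟩-emb : ∀ {V A B} {f : Hom V A} {g : Hom V B} → JointEmb f g → IsEmb ⟨ f , g ⟩
  ⟨,⟩-emb {A = A} {B} {f} {g} je x y le = je x y
    (Pt.trans A (Pt.reflexive A (Pt.Eq.sym A (U-π₁-⟨,⟩ x)))
      (Pt.trans A (U₁-mono π₁ le) (Pt.reflexive A (U-π₁-⟨,⟩ y))))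
    (Pt.trans B (Pt.reflexive B (Pt.Eq.sym B (U-π₂-⟨,⟩ x)))
      (Pt.trans B (U₁-mono π₂ le) (Pt.reflexive B (U-π₂-⟨,⟩ y))))

  surjEmb-section : ∀ {A B} {e : Hom A B} → IsSurj e → IsEmb e → Σ (Hom B A) λ d → e ∘ d ≈ id
  surjEmb-section {e = e} e-surj e-emb =
    let (d , _ , e∘d≈id) = diag e e id id e-surj e-emb (≈-trans identityʳ (≈-sym identityˡ))
    in d , e∘d≈id

  -- The pullback of m along f, built as an equaliser, has a projection onto W
  -- that is a surjective embedding; its section gives the factorisation.
  factor-through-emb : ∀ {W V C} (f : Hom W C) {m : Hom V C} → IsEmb m →
                       (∀ w → Σ ∣ V ∣ λ v → Eq C (U₁ m v) (U₁ f w)) →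
                       Σ (Hom W V) λ u → m ∘ u ≈ f
  factor-through-emb {W} {V} {C} f {m} m-emb f⊆m = k ∘ d , m∘k∘d≈f
    where
    ι : Hom (Eqz (f ∘ π₁) (m ∘ π₂)) (W ⊗ V)
    ι = eqz
    e = π₁ ∘ ι
    k = π₂ ∘ ι

    square : f ∘ e ≈ m ∘ k
    square = begin-equality
      f ∘ (π₁ ∘ ι)    ≈⟨ assoc ⟨
      (f ∘ π₁) ∘ ι    ≈⟨ eqz-eq ⟩
      (m ∘ π₂) ∘ ι    ≈⟨ assoc ⟩
      m ∘ (π₂ ∘ ι)    ∎
      where open HomReasoning

    e-surj : IsSurj e
    e-surj w with f⊆m w
    ... | v , mv≈fw with ⊗-surj w v
    ... | z , π₁z≈w , π₂z≈v = x , (let open PtReasoning W in begin-equality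
        U₁ e x             ≈⟨ U-comp ι π₁ x ⟩
        U₁ π₁ (U₁ ι x)     ≈⟨ U₁-cong π₁ ιx≈z ⟩
        U₁ π₁ z            ≈⟨ π₁z≈w ⟩
        w                  ∎)
      where
      agree : Eq C (U₁ (f ∘ π₁) z) (U₁ (m ∘ π₂) z)
      agree = begin-equality
        U₁ (f ∘ π₁) z      ≈⟨ U-comp π₁ f z ⟩
        U₁ f (U₁ π₁ z)     ≈⟨ U₁-cong f π₁z≈w ⟩
        U₁ f w             ≈⟨ mv≈fw ⟨
        U₁ m v             ≈⟨ U₁-cong m π₂z≈v ⟨
        U₁ m (U₁ π₂ z)     ≈⟨ U-comp π₂ m z ⟨
        U₁ (m ∘ π₂) z      ∎
        where open PtReasoning C
      x = proj₁ (eqz-img z agree)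
      ιx≈z = proj₂ (eqz-img z agree)

    e-emb : IsEmb e
    e-emb x y ex≤ey = jointEmb-∘ ⊗-emb eqz-emb x y ex≤ey (m-emb (U₁ k x) (U₁ k y) (begin
        U₁ m (U₁ k x)   ≈⟨ U-square square x ⟨
        U₁ f (U₁ e x)   ≤⟨ U₁-mono f ex≤ey ⟩
        U₁ f (U₁ e y)   ≈⟨ U-square square y ⟩
        U₁ m (U₁ k y)   ∎))
      where open PtReasoning C

    d = proj₁ (surjEmb-section e-surj e-emb)

    m∘k∘d≈f : m ∘ (k ∘ d) ≈ f
    m∘k∘d≈f = begin-equality
      m ∘ (k ∘ d)    ≈⟨ assoc ⟨
      (m ∘ k) ∘ d    ≈⟨ ∘-resp-≈ ≈-refl square ⟨
      (f ∘ e) ∘ d    ≈⟨ assoc ⟩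
      f ∘ (e ∘ d)    ≈⟨ ∘-resp-≈ (proj₂ (surjEmb-section e-surj e-emb)) ≈-refl ⟩
      f ∘ id         ≈⟨ identityʳ ⟩
      f              ∎
      where open HomReasoning

  record Span (A B : Obj) : Set (o ⊔ h) where
    constructor span
    field
      apex  : Obj
      left  : Hom apex A
      right : Hom apex B
  open Span public

  Hits : ∀ {A B} → Span A B → ∣ A ∣ → ∣ B ∣ → Set ℓ
  Hits {A} {B} s a b = Σ ∣ apex s ∣ λ w → Eq A (U₁ (left s) w) a × Eq B (U₁ (right s) w) b

  infix 4 _⊑_
  _⊑_ : ∀ {A B} → Span A B → Span A B → Set ℓ
  s ⊑ t = ∀ w → Hits t (U₁ (left s) w) (U₁ (right s) w)

  JointlyEmb : ∀ {A B} → Span A B → Set ℓ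
  JointlyEmb s = JointEmb (left s) (right s)

  SpanMorphism : ∀ {A B} (s t : Span A B) → Hom (apex s) (apex t) → Set r
  SpanMorphism s t u = (left t ∘ u ≈ left s) × (right t ∘ u ≈ right s)

  InRel : ∀ {A B} → WRel A B → Span A B → Set ℓ
  InRel R s = ∀ w → rel R (U₁ (left s) w) (U₁ (right s) w)

  Covers : ∀ {A B} → WRel A B → Span A B → Set ℓ
  Covers R s = ∀ a b → rel R a b → Hits s a b

  ⟨,⟩-cancel : ∀ {W V A B} {f : Hom V A} {g : Hom V B} {f' : Hom W A} {g' : Hom W B} {u : Hom W V} →
               ⟨ f , g ⟩ ∘ u ≈ ⟨ f' , g' ⟩ → (f ∘ u ≈ f') × (g ∘ u ≈ g')
  ⟨,⟩-cancel {f = f} {g} {f'} {g'} {u} ⟨⟩∘u≈⟨⟩ = cancel π₁-β π₁-β , cancel π₂-β π₂-β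
    where
    open HomReasoning
    cancel : ∀ {D} {π : Hom _ D} {k : Hom _ D} {k' : Hom _ D} →
             π ∘ ⟨ f , g ⟩ ≈ k → π ∘ ⟨ f' , g' ⟩ ≈ k' → k ∘ u ≈ k'
    cancel {π = π} {k} {k'} β β' = begin-equality
      k ∘ u                  ≈⟨ ∘-resp-≈ ≈-refl β ⟨
      (π ∘ ⟨ f , g ⟩) ∘ u    ≈⟨ assoc ⟩
      π ∘ (⟨ f , g ⟩ ∘ u)    ≈⟨ ∘-resp-≈ ⟨⟩∘u≈⟨⟩ ≈-refl ⟩
      π ∘ ⟨ f' , g' ⟩        ≈⟨ β' ⟩
      k'                     ∎

  ⊑-factor : ∀ {A B} {s t : Span A B} → JointlyEmb t → s ⊑ t → Σ (Hom (apex s) (apex t)) (SpanMorphism s t)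
  ⊑-factor {A} {B} {s} {t} t-emb s⊑t =
    let (u , ⟨⟩∘u≈⟨⟩) = factor-through-emb ⟨ left s , right s ⟩ (⟨,⟩-emb t-emb) lift
    in u , ⟨,⟩-cancel ⟨⟩∘u≈⟨⟩
    where
    lift : ∀ w → Σ ∣ apex t ∣ λ v → Eq (A ⊗ B) (U₁ ⟨ left t , right t ⟩ v) (U₁ ⟨ left s , right s ⟩ w)
    lift w = let (v , l≈ , r≈) = s⊑t w in v , jointEmb-≈ ⊗-emb
      (Pt.Eq.trans A (U-π₁-⟨,⟩ v) (Pt.Eq.trans A l≈ (Pt.Eq.sym A (U-π₁-⟨,⟩ w))))
      (Pt.Eq.trans B (U-π₂-⟨,⟩ v) (Pt.Eq.trans B r≈ (Pt.Eq.sym B (U-π₂-⟨,⟩ w))))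

  SpanMorphism-surj : ∀ {A B} {s t : Span A B} {u : Hom (apex s) (apex t)} →
                      JointlyEmb t → t ⊑ s → SpanMorphism s t u → IsSurj u
  SpanMorphism-surj {A} {B} {s} {t} {u} t-emb t⊑s (l∘u≈l , r∘u≈r) v =
    let (w , l≈ , r≈) = t⊑s v
    in w , jointEmb-≈ t-emb (Pt.Eq.trans A (U-triangle l∘u≈l w) l≈) (Pt.Eq.trans B (U-triangle r∘u≈r w) r≈)

  SpanMorphism-Hits : ∀ {A B} {s t : Span A B} {u : Hom (apex s) (apex t)} → SpanMorphism s t u →
                      ∀ {a b} → Hits s a b → Hits t a b
  SpanMorphism-Hits {A} {B} (l∘u≈l , r∘u≈r) (w , l≈ , r≈) =
    _ , Pt.Eq.trans A (U-triangle l∘u≈l w) l≈ , Pt.Eq.trans B (U-triangle r∘u≈r w) r≈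

  rel-resp-Eq : ∀ {A B} (R : WRel A B) {a a' b b'} → Eq A a a' → Eq B b b' → rel R a b → rel R a' b'
  rel-resp-Eq {A} {B} R a≈a' b≈b' =
    λ aRb → weaken R (Pt.reflexive A (Pt.Eq.sym A a≈a')) aRb (Pt.reflexive B b≈b')

  InRel-Hits : ∀ {A B} {R : WRel A B} {s : Span A B} → InRel R s → ∀ {a b} → Hits s a b → rel R a b
  InRel-Hits {R = R} s-in (w , l≈ , r≈) = rel-resp-Eq R l≈ r≈ (s-in w)

  InRel-⊑ : ∀ {A B} {R : WRel A B} {s t : Span A B} → InRel R s → Covers R t → s ⊑ t
  InRel-⊑ s-in t-cov w = t-cov _ _ (s-in w)

  InRel-surj : ∀ {A B} {R : WRel A B} {s t : Span A B} {u : Hom (apex s) (apex t)} →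
               SpanMorphism s t u → IsSurj u → InRel R s → InRel R t
  InRel-surj {A} {B} {R} {t = t} (l∘u≈l , r∘u≈r) u-surj s-in v =
    let (w , uw≈v) = u-surj v
    in rel-resp-Eq R
         (Pt.Eq.trans A (Pt.Eq.sym A (U-triangle l∘u≈l w)) (U₁-cong (left t) uw≈v))
         (Pt.Eq.trans B (Pt.Eq.sym B (U-triangle r∘u≈r w)) (U₁-cong (right t) uw≈v))
         (s-in w)

  tabulation : ∀ {A B} (R : WRel A B) → IsCRel R → Span A B
  tabulation _ (W , p , q , _) = span W p q

  tabulation-jointlyEmb : ∀ {A B} (R : WRel A B) (c : IsCRel R) → JointlyEmb (tabulation R c)
  tabulation-jointlyEmb _ (_ , _ , _ , _ , je) = je

  tabulation-in : ∀ {A B} (R : WRel A B) (c : IsCRel R) → InRel R (tabulation R c)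
  tabulation-in {A} {B} _ (_ , _ , _ , graph , _) w = proj₂ (graph _ _) (w , Pt.Eq.refl A , Pt.Eq.refl B)

  tabulation-covers : ∀ {A B} (R : WRel A B) (c : IsCRel R) → Covers R (tabulation R c)
  tabulation-covers _ (_ , _ , _ , graph , _) a b = proj₁ (graph a b)

  jointlyEmb-tabulation⇒crel : ∀ {A B} {R : WRel A B} (s : Span A B) →
                               JointlyEmb s → InRel R s → Covers R s → IsCRel R
  jointlyEmb-tabulation⇒crel {R = R} (span W p q) je s-in s-cov =
    W , p , q , (λ a b → s-cov a b , InRel-Hits {R = R} s-in) , je

  -- Replace the span by its image, the (surjection, embedding)-factorisation of ⟨ left , right ⟩.
  tabulation⇒crel : ∀ {A B} {R : WRel A B} (s : Span A B) → InRel R s → Covers R s → IsCRel R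
  tabulation⇒crel {R = R} s s-in s-cov with fact ⟨ left s , right s ⟩
  ... | I , e , m , e-surj , m-emb , m∘e≈⟨⟩ =
    jointlyEmb-tabulation⇒crel {R = R} t (jointEmb-∘ ⊗-emb m-emb)
      (InRel-surj {R = R} e-mor e-surj s-in)
      (λ a b aRb → SpanMorphism-Hits e-mor (s-cov a b aRb))
    where
    t = span I (π₁ ∘ m) (π₂ ∘ m)
    e-mor : SpanMorphism s t e
    e-mor = leg π₁-β , leg π₂-β
      where
      leg : ∀ {D} {π : Hom _ D} {k : Hom _ D} → π ∘ ⟨ left s , right s ⟩ ≈ k → (π ∘ m) ∘ e ≈ k
      leg π∘⟨⟩≈k = ≈-trans assoc (≈-trans (∘-resp-≈ m∘e≈⟨⟩ ≈-refl) π∘⟨⟩≈k)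

  IsCRel-resp-≐ : ∀ {A B} {R S : WRel A B} → R ≐ S → IsCRel R → IsCRel S
  IsCRel-resp-≐ {R = R} {S} (R⊆S , S⊆R) c =
    jointlyEmb-tabulation⇒crel {R = S} (tabulation R c) (tabulation-jointlyEmb R c)
      (λ w → R⊆S _ _ (tabulation-in R c w)) (λ a b aSb → tabulation-covers R c a b (S⊆R a b aSb))

  into-tabulation : ∀ {A B} (R : WRel A B) (c : IsCRel R) {s : Span A B} → InRel R s →
                    Σ (Hom (apex s) (apex (tabulation R c))) (SpanMorphism s (tabulation R c))
  into-tabulation R c s-in = ⊑-factor (tabulation-jointlyEmb R c) (InRel-⊑ {R = R} s-in (tabulation-covers R c))

  onto-tabulation : ∀ {A B} (R : WRel A B) (c : IsCRel R) {s : Span A B} → InRel R s → Covers R s →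
                    Σ (Hom (apex s) (apex (tabulation R c))) λ u → SpanMorphism s (tabulation R c) u × IsSurj u
  onto-tabulation R c s-in s-cov =
    let (u , u-mor) = into-tabulation R c s-in
    in u , u-mor , SpanMorphism-surj (tabulation-jointlyEmb R c) (InRel-⊑ {R = R} (tabulation-in R c) s-cov) u-mor

  tabulation-decomposition : ∀ {A B} {R : WRel A B} {s : Span A B} → InRel R s → Covers R s →
                             R ≐ right s ₊ · left s ⁺
  tabulation-decomposition {A} {B} {R} s-in s-cov =
      (λ a b aRb → let (w , l≈a , r≈b) = s-cov a b aRb
                   in w , Pt.reflexive A (Pt.Eq.sym A l≈a) , Pt.reflexive B r≈b)
    , λ { a b (w , a≤l , r≤b) → weaken R a≤l (s-in w) r≤b }

  ≐-refl : ∀ {A B} {R : WRel A B} → R ≐ R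
  ≐-refl = (λ _ _ aRb → aRb) , (λ _ _ aRb → aRb)

  ≐-sym : ∀ {A B} {R S : WRel A B} → R ≐ S → S ≐ R
  ≐-sym (R⊆S , S⊆R) = S⊆R , R⊆S

  ≐-trans : ∀ {A B} {R S T : WRel A B} → R ≐ S → S ≐ T → R ≐ T
  ≐-trans (R⊆S , S⊆R) (S⊆T , T⊆S) =
    (λ a b aRb → S⊆T a b (R⊆S a b aRb)) , (λ a b aTb → S⊆R a b (T⊆S a b aTb))

  commaRel : ∀ {A B C} → Hom A C → Hom B C → WRel A B
  commaRel {C = C} f g = record
    { rel    = λ a b → Le C (U₁ f a) (U₁ g b)
    ; weaken = λ a'≤a fa≤gb b≤b' → Pt.trans C (U₁-mono f a'≤a) (Pt.trans C fa≤gb (U₁-mono g b≤b'))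
    }

  commaSpan : ∀ {A B C} → Hom A C → Hom B C → Span A B
  commaSpan f g = span (Comma f g) cp cq

  commaRel-crel : ∀ {A B C} (f : Hom A C) (g : Hom B C) → IsCRel (commaRel f g)
  commaRel-crel f g = jointlyEmb-tabulation⇒crel {R = commaRel f g} (commaSpan f g) c-emb
    (U-square-≤ c-cell) c-img

  commaRel-idʳ : ∀ {A B} (f : Hom A B) → commaRel f id ≐ f ₊
  commaRel-idʳ {B = B} f =
      (λ a b fa≤b → Pt.trans B fa≤b (Pt.reflexive B (U-id b)))
    , (λ a b fa≤b → Pt.trans B fa≤b (Pt.reflexive B (Pt.Eq.sym B (U-id b))))

  commaRel-idˡ : ∀ {A B} (f : Hom A B) → commaRel id f ≐ f ⁺
  commaRel-idˡ {B = B} f =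
      (λ b a b≤fa → Pt.trans B (Pt.reflexive B (Pt.Eq.sym B (U-id b))) b≤fa)
    , (λ b a b≤fa → Pt.trans B (Pt.reflexive B (U-id b)) b≤fa)

  ₊-id : ∀ {A} → id {A} ₊ ≐ IdR A
  ₊-id {A} =
      (λ a a' a≤a' → Pt.trans A (Pt.reflexive A (Pt.Eq.sym A (U-id a))) a≤a')
    , (λ a a' a≤a' → Pt.trans A (Pt.reflexive A (U-id a)) a≤a')

  infixr 9 _⨾_
  _⨾_ : ∀ {A B C} → Span A B → Span B C → Span A C
  s ⨾ t = span (Comma (right s) (left t)) (left s ∘ cp) (right t ∘ cq)

  ⨾-in : ∀ {A B C} {R : WRel A B} {S : WRel B C} {s : Span A B} {t : Span B C} →
         InRel R s → InRel S t → InRel (S · R) (s ⨾ t)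
  ⨾-in {A} {B} {C} {R} {S} {s} {t} s-in t-in k =
      U₁ (right s) (U₁ cp k)
    , rel-resp-Eq R (Pt.Eq.sym A (U-comp cp (left s) k)) (Pt.Eq.refl B) (s-in (U₁ cp k))
    , weaken S (U-square-≤ c-cell k) (t-in (U₁ cq k)) (Pt.reflexive C (Pt.Eq.sym C (U-comp cq (right t) k)))

  ⨾-covers : ∀ {A B C} {R : WRel A B} {S : WRel B C} {s : Span A B} {t : Span B C} →
             Covers R s → Covers S t → Covers (S · R) (s ⨾ t)
  ⨾-covers {A} {B} {C} {s = s} {t} s-cov t-cov a c (b , aRb , bSc)
    with s-cov a b aRb | t-cov b c bSc
  ... | w₁ , l₁≈a , r₁≈b | w₂ , l₂≈b , r₂≈c
    with c-img {f = right s} {left t} w₁ w₂ (Pt.reflexive B (Pt.Eq.trans B r₁≈b (Pt.Eq.sym B l₂≈b)))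
  ... | k , cpk≈w₁ , cqk≈w₂ =
      k
    , Pt.Eq.trans A (U-comp cp (left s) k) (Pt.Eq.trans A (U₁-cong (left s) cpk≈w₁) l₁≈a)
    , Pt.Eq.trans C (U-comp cq (right t) k) (Pt.Eq.trans C (U₁-cong (right t) cqk≈w₂) r₂≈c)

  ·-crel : ∀ {A B C} (R : WRel A B) (S : WRel B C) → IsCRel R → IsCRel S → IsCRel (S · R)
  ·-crel R S c d = tabulation⇒crel {R = S · R} (tabulation R c ⨾ tabulation S d)
    (⨾-in {R = R} {S} (tabulation-in R c) (tabulation-in S d))
    (⨾-covers {R = R} {S} (tabulation-covers R c) (tabulation-covers S d))

  _⁺R : ∀ {A B} → Hom A B → RelArr B A
  f ⁺R = record
    { wrel = f ⁺ ; crel = IsCRel-resp-≐ {R = commaRel id f} {f ⁺} (commaRel-idˡ f) (commaRel-crel id f) }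

  idR : ∀ A → RelArr A A
  idR A = record { wrel = IdR A ; crel = IsCRel-resp-≐ {R = id ₊} {IdR A} ₊-id (₊-crel id) }

  infixr 9 _·R_
  _·R_ : ∀ {A B C} → RelArr B C → RelArr A B → RelArr A C
  S ·R R = record { wrel = wrel S · wrel R ; crel = ·-crel (wrel R) (wrel S) (crel R) (crel S) }

  tabulation-exact : ∀ {A B C} {f : Hom A C} {g : Hom B C} (R : WRel A B) (c : IsCRel R) →
                     R ≐ commaRel f g → Exact (left (tabulation R c)) (right (tabulation R c)) f g
  tabulation-exact {A} {B} {C} {f} {g} R c (R⊆comma , comma⊆R) =
      U-refl (λ w → Pt.trans C (Pt.reflexive C (U-comp p f w))
                      (Pt.trans C (R⊆comma _ _ (tabulation-in R c w))
                                  (Pt.reflexive C (Pt.Eq.sym C (U-comp q g w)))))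
    , λ x y fx≤gy → let (w , pw≈x , qw≈y) = tabulation-covers R c x y (comma⊆R x y fx≤gy)
                    in w , Pt.reflexive A (Pt.Eq.sym A pw≈x) , Pt.reflexive B qw≈y
    where
    p = left (tabulation R c)
    q = right (tabulation R c)

  commaSpan-exact : ∀ {A B C} (f : Hom A C) (g : Hom B C) → Exact cp cq f g
  commaSpan-exact f g = tabulation-exact (commaRel f g) (commaRel-crel f g) (≐-refl {R = commaRel f g})

  ₊-∘ : ∀ {A B C} (f : Hom A B) (g : Hom B C) → (g ∘ f) ₊ ≐ g ₊ · f ₊
  ₊-∘ {B = B} {C} f g =
      (λ a c gfa≤c → U₁ f a , Pt.refl B , Pt.trans C (Pt.reflexive C (Pt.Eq.sym C (U-comp f g a))) gfa≤c)
    , λ { a c (b , fa≤b , gb≤c) →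
          Pt.trans C (Pt.reflexive C (U-comp f g a)) (Pt.trans C (U₁-mono g fa≤b) gb≤c) }

  ₊-antitone : ∀ {A B} {f g : Hom A B} → f ≤ g → g ₊ ⊆ f ₊
  ₊-antitone {B = B} f≤g a b ga≤b = Pt.trans B (U-pres f≤g a) ga≤b

  ₊⊣⁺-unit : ∀ {A B} (f : Hom A B) → IdR A ⊆ f ⁺ · f ₊
  ₊⊣⁺-unit {B = B} f a a' a≤a' = U₁ f a , Pt.refl B , U₁-mono f a≤a'

  ₊⊣⁺-counit : ∀ {A B} (f : Hom A B) → f ₊ · f ⁺ ⊆ IdR B
  ₊⊣⁺-counit {B = B} f b b' (a , b≤fa , fa≤b') = Pt.trans B b≤fa fa≤b'

  exact⇒₊·⁺ : ∀ {W X₁ X₂ Z} {p : Hom W X₁} {q : Hom W X₂} {f : Hom X₁ Z} {g : Hom X₂ Z} →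
              Exact p q f g → q ₊ · p ⁺ ≐ g ⁺ · f ₊
  exact⇒₊·⁺ {Z = Z} {p} {q} {f} {g} (cell , lift) =
      (λ { x y (w , x≤pw , qw≤y) → U₁ f x , Pt.refl Z , (begin
          U₁ f x            ≤⟨ U₁-mono f x≤pw ⟩
          U₁ f (U₁ p w)     ≤⟨ U-square-≤ cell w ⟩
          U₁ g (U₁ q w)     ≤⟨ U₁-mono g qw≤y ⟩
          U₁ g y            ∎) })
    , λ { x y (z , fx≤z , z≤gy) → lift x y (Pt.trans Z fx≤z z≤gy) }
    where open PtReasoning Z

  surj⇒₊·⁺ : ∀ {A B} (e : Hom A B) → IsSurj e → e ₊ · e ⁺ ≐ IdR B
  surj⇒₊·⁺ {B = B} e e-surj =
      ₊⊣⁺-counit e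
    , λ b b' b≤b' → let (a , ea≈b) = e-surj b
                    in a , Pt.reflexive B (Pt.Eq.sym B ea≈b) , Pt.trans B (Pt.reflexive B ea≈b) b≤b'

  ₊-properties : StarProps.Properties X
  ₊-properties =
      (₊-∘ , ₊-id , ₊-antitone)
    , (λ f → f ⁺R , ₊⊣⁺-unit f , ₊⊣⁺-counit f)
    , (λ p q f g → exact⇒₊·⁺)
    , surj⇒₊·⁺

module UniversalPropertyOf₊ {o h r ℓ o' h' r'} (X : ConcOrdReg o h r ℓ) (K : PosCat o' h' r') where
  open ConcOrdReg X
  open RelDefs X
  open Concrete X
  open Universal X K
  open PosCatProperties K

  module _ (H : RelFunctor) where

    H-resp-≐ : ∀ {A B} {R S : RelArr A B} → wrel R ≐ wrel S → H₁ H R K.≈ H₁ H S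
    H-resp-≐ (R⊆S , S⊆R) = H-mono H R⊆S , H-mono H S⊆R

    H-∘ : ∀ {A B C} (R : RelArr A B) (S : RelArr B C) → H₁ H (S ·R R) K.≈ H₁ H S K.∘ H₁ H R
    H-∘ R S = H-comp H R S (crel (S ·R R))

    H-⊣ : ∀ {A B} (R : RelArr A B) (S : RelArr B A) →
          IdR A ⊆ wrel S · wrel R → wrel R · wrel S ⊆ IdR B → H₁ H R ⊣ H₁ H S
    H-⊣ {A} {B} R S unit counit =
        (begin
          K.id                  ≈⟨ H-id H (crel (idR A)) ⟨
          H₁ H (idR A)          ≤⟨ H-mono H unit ⟩
          H₁ H (S ·R R)         ≈⟨ H-∘ R S ⟩
          H₁ H S K.∘ H₁ H R     ∎)
      , (begin
          H₁ H R K.∘ H₁ H S     ≈⟨ H-∘ S R ⟨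
          H₁ H (R ·R S)         ≤⟨ H-mono H counit ⟩
          H₁ H (idR B)          ≈⟨ H-id H (crel (idR B)) ⟩
          K.id                  ∎)
      where open HomReasoning

    H-₊⊣⁺ : ∀ {A B} (f : Hom A B) → H∘₊₁ H f ⊣ H₁ H (f ⁺R)
    H-₊⊣⁺ f = H-⊣ (f ₊R) (f ⁺R) (₊⊣⁺-unit f) (₊⊣⁺-counit f)

    H-tabulation : ∀ {A B} (R : RelArr A B) → let s = tabulation (wrel R) (crel R) in
                   H₁ H R K.≈ H∘₊₁ H (right s) K.∘ H₁ H (left s ⁺R)
    H-tabulation R = ≈-trans
      (H-resp-≐ {R = R} {(right s ₊R) ·R (left s ⁺R)}
        (tabulation-decomposition {R = wrel R} (tabulation-in (wrel R) (crel R)) (tabulation-covers (wrel R) (crel R))))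
      (H-∘ (left s ⁺R) (right s ₊R))
      where s = tabulation (wrel R) (crel R)

    restriction-isFunctor : IsPosFunctor cat (K co) (H₀ H) (H∘₊₁ H)
    restriction-isFunctor = record
      { F-mono = λ f≤g → H-mono H (₊-antitone f≤g)
      ; F-id   = ≈-sym (≈-trans (H-resp-≐ {R = id ₊R} {idR _} ₊-id) (H-id H (crel (idR _))))
      ; F-comp = λ f g → ≈-sym (≈-trans (H-resp-≐ {R = (g ∘ f) ₊R} {(g ₊R) ·R (f ₊R)} (₊-∘ f g))
                                          (H-∘ (f ₊R) (g ₊R)))
      }

    restriction-props : Props (H₀ H) (H∘₊₁ H)
    restriction-props =
        (λ f → H₁ H (f ⁺R) , H-₊⊣⁺ f)
      , (λ p q f g exact → ≈-trans (≈-sym (H-∘ (p ⁺R) (q ₊R)))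
           (≈-trans (H-resp-≐ {R = (q ₊R) ·R (p ⁺R)} {(g ⁺R) ·R (f ₊R)} (exact⇒₊·⁺ exact))
                    (H-∘ (f ₊R) (g ⁺R))))
      , λ e e-surj → ≈-trans (≈-sym (H-∘ (e ⁺R) (e ₊R)))
           (≈-trans (H-resp-≐ {R = (e ₊R) ·R (e ⁺R)} {idR _} (surj⇒₊·⁺ e e-surj))
                    (H-id H (crel (idR _))))

  restriction-injective : ∀ H H' → FunEq (H₀ H) (H₀ H') (H∘₊₁ H) (H∘₊₁ H') → RelFunEq H H'
  restriction-injective H H' (e , H₊≈H'₊) = e , λ {A} {B} R →
    let s = tabulation (wrel R) (crel R)
        p = left s
        q = right s
        T : ∀ {C D} → K.Hom (H₀ H C) (H₀ H D) → K.Hom (H₀ H' C) (H₀ H' D)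
        T {C} {D} = subst₂ K.Hom (e C) (e D)
        H⁺≈H'⁺ : T (H₁ H (p ⁺R)) K.≈ H₁ H' (p ⁺R)
        H⁺≈H'⁺ = ⊣-rightAdjoint-unique
          (⊣-respˡ-≈ (H₊≈H'₊ p) (subst₂-⊣ (e (apex s)) (e A) (H-₊⊣⁺ H p))) (H-₊⊣⁺ H' p)
    in begin-equality
      T (H₁ H R)                                    ≈⟨ subst₂-resp-≈ (e A) (e B) (H-tabulation H R) ⟩
      T (H∘₊₁ H q K.∘ H₁ H (p ⁺R))                  ≈⟨ subst₂-∘ (e A) (e (apex s)) (e B) _ _ ⟩
      T (H∘₊₁ H q) K.∘ T (H₁ H (p ⁺R))              ≈⟨ ∘-resp-≈ H⁺≈H'⁺ (H₊≈H'₊ q) ⟩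
      H∘₊₁ H' q K.∘ H₁ H' (p ⁺R)                    ≈⟨ H-tabulation H' R ⟨
      H₁ H' R                                       ∎
    where open HomReasoning

  module Extension (F : PosFunctor cat (K co)) (props : Props (PosFunctor.F₀ F) (PosFunctor.F₁ F)) where
    open PosFunctor F
    open IsPosFunctor isFun

    F-resp-≈ : ∀ {A B} {f g : Hom A B} → f ≈ g → F₁ f K.≈ F₁ g
    F-resp-≈ (f≤g , g≤f) = F-mono g≤f , F-mono f≤g

    F-∘ : ∀ {A B C} (f : Hom A B) (g : Hom B C) → F₁ (g ∘ f) K.≈ F₁ g K.∘ F₁ f
    F-∘ f g = ≈-sym (F-comp f g)

    F-identity : ∀ {A} → F₁ (id {A}) K.≈ K.id
    F-identity = ≈-sym F-id

    Fʳ : ∀ {A B} → Hom A B → K.Hom (F₀ B) (F₀ A)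
    Fʳ f = proj₁ (proj₁ props f)

    F⊣Fʳ : ∀ {A B} (f : Hom A B) → F₁ f ⊣ Fʳ f
    F⊣Fʳ f = proj₂ (proj₁ props f)

    Fʳ-resp-≈ : ∀ {A B} {f g : Hom A B} → f ≈ g → Fʳ f K.≈ Fʳ g
    Fʳ-resp-≈ {f = f} {g} f≈g = ⊣-rightAdjoint-unique (⊣-respˡ-≈ (F-resp-≈ f≈g) (F⊣Fʳ f)) (F⊣Fʳ g)

    Fʳ-∘ : ∀ {A B C} (f : Hom A B) (g : Hom B C) → Fʳ (g ∘ f) K.≈ Fʳ f K.∘ Fʳ g
    Fʳ-∘ f g =
      ⊣-rightAdjoint-unique (F⊣Fʳ (g ∘ f)) (⊣-respˡ-≈ (≈-sym (F-∘ f g)) (⊣-∘ (F⊣Fʳ f) (F⊣Fʳ g)))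

    Fʳ-identity : ∀ {A} → Fʳ (id {A}) K.≈ K.id
    Fʳ-identity = ⊣-rightAdjoint-unique (F⊣Fʳ id) (⊣-respˡ-≈ (≈-sym F-identity) ⊣-id)

    F-exact : ∀ {W X₁ X₂ Z} {p : Hom W X₁} {q : Hom W X₂} {f : Hom X₁ Z} {g : Hom X₂ Z} →
              Exact p q f g → F₁ q K.∘ Fʳ p K.≈ Fʳ g K.∘ F₁ f
    F-exact {p = p} {q} {f} {g} = proj₁ (proj₂ props) p q f g

    F-surj : ∀ {A B} {e : Hom A B} → IsSurj e → F₁ e K.∘ Fʳ e K.≈ K.id
    F-surj {e = e} = proj₂ (proj₂ props) e

    spanArrow : ∀ {A B} → Span A B → K.Hom (F₀ A) (F₀ B)
    spanArrow s = F₁ (right s) K.∘ Fʳ (left s)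

    spanArrow-via : ∀ {A B} {s t : Span A B} {u : Hom (apex s) (apex t)} → SpanMorphism s t u →
                    spanArrow s K.≈ F₁ (right t) K.∘ ((F₁ u K.∘ Fʳ u) K.∘ Fʳ (left t))
    spanArrow-via {s = s} {t} {u} (p∘u≈ , q∘u≈) = begin-equality
      F₁ (right s) K.∘ Fʳ (left s)          ≈⟨ ∘-resp-≈ (Fʳ-resp-≈ p∘u≈) (F-resp-≈ q∘u≈) ⟨
      F₁ (q ∘ u) K.∘ Fʳ (p ∘ u)             ≈⟨ ∘-resp-≈ (Fʳ-∘ u p) (F-∘ u q) ⟩
      (F₁ q K.∘ F₁ u) K.∘ (Fʳ u K.∘ Fʳ p)   ≈⟨ K.assoc ⟩
      F₁ q K.∘ (F₁ u K.∘ (Fʳ u K.∘ Fʳ p))   ≈⟨ ∘-resp-≈ K.assoc ≈-refl ⟨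
      F₁ q K.∘ ((F₁ u K.∘ Fʳ u) K.∘ Fʳ p)   ∎
      where
      open HomReasoning
      p = left t
      q = right t

    spanArrow-mono : ∀ {A B} {s t : Span A B} {u : Hom (apex s) (apex t)} → SpanMorphism s t u →
                     spanArrow s K.≤ spanArrow t
    spanArrow-mono {s = s} {t} {u} u-mor = begin
      spanArrow s                                 ≈⟨ spanArrow-via u-mor ⟩
      F₁ q K.∘ ((F₁ u K.∘ Fʳ u) K.∘ Fʳ p)         ≤⟨ K.∘-mono (K.∘-mono K.≤-refl counit) K.≤-refl ⟩
      F₁ q K.∘ (K.id K.∘ Fʳ p)                    ≈⟨ ∘-resp-≈ K.identityˡ ≈-refl ⟩
      spanArrow t                                 ∎
      where
      open HomReasoning
      p = left t
      q = right t
      counit = proj₂ (F⊣Fʳ u)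

    spanArrow-surj : ∀ {A B} {s t : Span A B} {u : Hom (apex s) (apex t)} → SpanMorphism s t u →
                     IsSurj u → spanArrow s K.≈ spanArrow t
    spanArrow-surj {s = s} {t} {u} u-mor u-surj = begin-equality
      spanArrow s                                 ≈⟨ spanArrow-via u-mor ⟩
      F₁ q K.∘ ((F₁ u K.∘ Fʳ u) K.∘ Fʳ p)         ≈⟨ ∘-resp-≈ (∘-resp-≈ ≈-refl counit) ≈-refl ⟩
      F₁ q K.∘ (K.id K.∘ Fʳ p)                    ≈⟨ ∘-resp-≈ K.identityˡ ≈-refl ⟩
      spanArrow t                                 ∎
      where
      open HomReasoning
      p = left t
      q = right t
      counit = F-surj u-surj

    spanArrow-⨾ : ∀ {A B C} (s : Span A B) (t : Span B C) → spanArrow (s ⨾ t) K.≈ spanArrow t K.∘ spanArrow s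
    spanArrow-⨾ s t = begin-equality
      F₁ (q₂ ∘ cq) K.∘ Fʳ (p₁ ∘ cp)                 ≈⟨ ∘-resp-≈ (Fʳ-∘ cp p₁) (F-∘ cq q₂) ⟩
      (F₁ q₂ K.∘ F₁ cq) K.∘ (Fʳ cp K.∘ Fʳ p₁)       ≈⟨ K.assoc ⟩
      F₁ q₂ K.∘ (F₁ cq K.∘ (Fʳ cp K.∘ Fʳ p₁))       ≈⟨ ∘-resp-≈ K.assoc ≈-refl ⟨
      F₁ q₂ K.∘ ((F₁ cq K.∘ Fʳ cp) K.∘ Fʳ p₁)       ≈⟨ ∘-resp-≈ (∘-resp-≈ ≈-refl exact) ≈-refl ⟩
      F₁ q₂ K.∘ ((Fʳ p₂ K.∘ F₁ q₁) K.∘ Fʳ p₁)       ≈⟨ ∘-resp-≈ K.assoc ≈-refl ⟩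
      F₁ q₂ K.∘ (Fʳ p₂ K.∘ (F₁ q₁ K.∘ Fʳ p₁))       ≈⟨ K.assoc ⟨
      (F₁ q₂ K.∘ Fʳ p₂) K.∘ (F₁ q₁ K.∘ Fʳ p₁)       ∎
      where
      open HomReasoning
      p₁ = left s
      q₁ = right s
      p₂ = left t
      q₂ = right t
      exact : F₁ cq K.∘ Fʳ cp K.≈ Fʳ p₂ K.∘ F₁ q₁
      exact = F-exact (commaSpan-exact q₁ p₂)

    extension₁ : ∀ {A B} → RelArr A B → K.Hom (F₀ A) (F₀ B)
    extension₁ R = spanArrow (tabulation (wrel R) (crel R))

    extension-mono : ∀ {A B} {R S : RelArr A B} → wrel R ⊆ wrel S → extension₁ R K.≤ extension₁ S
    extension-mono {R = R} {S} R⊆S = spanArrow-mono (proj₂ (into-tabulation (wrel S) (crel S)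
      (λ w → R⊆S _ _ (tabulation-in (wrel R) (crel R) w))))

    extension-id : ∀ {A} (c : IsCRel (IdR A)) → extension₁ (record { wrel = IdR A ; crel = c }) K.≈ K.id
    extension-id {A} c = begin-equality
      spanArrow (tabulation (IdR A) c)   ≈⟨ F-exact (tabulation-exact (IdR A) c IdR≐commaRel) ⟩
      Fʳ id K.∘ F₁ id                    ≈⟨ ∘-resp-≈ F-identity Fʳ-identity ⟩
      K.id K.∘ K.id                      ≈⟨ K.identityˡ ⟩
      K.id                               ∎
      where
      open HomReasoning
      IdR≐commaRel : IdR A ≐ commaRel id id
      IdR≐commaRel = ≐-trans {R = IdR A} {id ₊} {commaRel id id} (≐-sym {R = id ₊} {IdR A} ₊-id)
                              (≐-sym {R = commaRel id id} {id ₊} (commaRel-idʳ id))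

    extension-comp : ∀ {A B C} (R : RelArr A B) (S : RelArr B C) (c : IsCRel (wrel S · wrel R)) →
                     extension₁ (record { wrel = wrel S · wrel R ; crel = c }) K.≈ extension₁ S K.∘ extension₁ R
    extension-comp R S c =
      let (_ , u-mor , u-surj) = onto-tabulation (wrel S · wrel R) c
            (⨾-in {R = wrel R} {wrel S} (tabulation-in (wrel R) (crel R)) (tabulation-in (wrel S) (crel S)))
            (⨾-covers {R = wrel R} {wrel S} (tabulation-covers (wrel R) (crel R)) (tabulation-covers (wrel S) (crel S)))
      in ≈-trans (≈-sym (spanArrow-surj u-mor u-surj))
                 (spanArrow-⨾ (tabulation (wrel R) (crel R)) (tabulation (wrel S) (crel S)))

    extension : RelFunctor
    extension = record
      { H₀ = F₀ ; H₁ = extension₁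
      ; H-mono = λ {_} {_} {R} {S} → extension-mono {R = R} {S}
      ; H-id = extension-id ; H-comp = extension-comp }

    extension-restricts : FunEq F₀ F₀ (H∘₊₁ extension) F₁
    extension-restricts = (λ _ → refl) , λ f →
      ≈-trans (F-exact (commaSpan-exact f id)) (≈-trans (∘-resp-≈ ≈-refl Fʳ-identity) K.identityˡ)

  universal : UniversalProperty
  universal =
      (λ H → restriction-isFunctor H , restriction-props H)
    , restriction-injective
    , λ F props → Extension.extension F props , Extension.extension-restricts F props

theorem6p11 : ∀ {o h r ℓ o' h' r' ℓ'} (X : ConcOrdReg o h r ℓ) →
    StarProps.Properties X ×
    ((𝒦 : ConcOrdReg o' h' r' ℓ') → Universal.UniversalProperty X (ConcOrdReg.cat 𝒦))
theorem6p11 X = Concrete.₊-properties X , λ 𝒦 → UniversalPropertyOf₊.universal X (ConcOrdReg.cat 𝒦)
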